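{- If $f:\{ -1,1\}^n\to\{ -1,1\}$ is low-correlation self-predicting, then $f$ is either balanced (i.e., $\Pr(f(X^n)=1)=1/2$ for $X^n$ uniform on $\{ -1,1\}^n$) or constant.
   Context: For $\rho\in[0,1]$ and $f:\{ -1,1\}^n\to\{ -1,1\}$, $T_\rho f(y^n)=\sum_{S\subseteq[n]}\rho^{|S|}\hat f_S\prod_{i\in S}y_i$, where $\hat f_S=\mathbb{E}[f(X^n)\prod_{i\in S}X_i]$; equivalently $T_\rho f(y^n)=\mathbb{E}[f(X^n)\mid Y^n=y^n]$ with $Y^n$ obtained by flipping each coordinate of $X^n$ independently with probability $(1-\rho)/2$. $\operatorname{sgn}(0)=0$. $f$ is $\rho$-SP if $f(y^n)=\operatorname{sgn}T_\rho f(y^n)$ for all $y^n$ with $T_\rho f(y^n)\ne0$. $f$ is low-correlation self-predicting (LCSP) if there is $\rho^*>0$ such that $f$ is $\rho$-SP for all $\rho\in[0,\rho^*)$. -}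

module Defs where

open import Data.Bool using (Bool; true; false; if_then_else_)
open import Data.Nat using (ℕ; zero; suc)
open import Data.Fin using (Fin; zero; suc)
open import Data.List using (List; []; _∷_; map; _++_; foldr; concatMap)
open import Data.Rational using (ℚ; 0ℚ; 1ℚ; ½; _+_; _*_; -_; _<_; _≤_)
open import Data.Rational.Properties using (_<?_)
open import Relation.Nullary.Decidable using (⌊_⌋)
open import Data.Product using (Σ; _×_; ∃)
open import Relation.Binary.PropositionalEquality using (_≡_; _≢_)

-- A point of {-1,1}^n is a function Fin n → Bool, with true ↦ +1, false ↦ -1.
Cube : ℕ → Set
Cube n = Fin n → Bool

-- A subset S ⊆ [n] is its indicator Fin n → Bool.
SubsetOf : ℕ → Set
SubsetOf n = Fin n → Bool

val : Bool → ℚ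
val true  = 1ℚ
val false = - 1ℚ

cons : ∀ {n} → Bool → (Fin n → Bool) → Fin (suc n) → Bool
cons b x zero    = b
cons b x (suc i) = x i

allCube : (n : ℕ) → List (Cube n)
allCube zero    = (λ ()) ∷ []
allCube (suc n) = map (cons true) (allCube n) ++ map (cons false) (allCube n)

sumℚ : List ℚ → ℚ
sumℚ = foldr _+_ 0ℚ

Σcube : (n : ℕ) → (Cube n → ℚ) → ℚ
Σcube n g = sumℚ (map g (allCube n))

_^ℚ_ : ℚ → ℕ → ℚ
q ^ℚ zero  = 1ℚ
q ^ℚ suc k = q * (q ^ℚ k)

𝔼 : (n : ℕ) → (Cube n → ℚ) → ℚ
𝔼 n g = (½ ^ℚ n) * Σcube n g

χ : (n : ℕ) → SubsetOf n → Cube n → ℚ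
χ zero    S y = 1ℚ
χ (suc n) S y =
  (if S zero then val (y zero) else 1ℚ) * χ n (λ i → S (suc i)) (λ i → y (suc i))

card : (n : ℕ) → SubsetOf n → ℕ
card zero    S = 0
card (suc n) S = (if S zero then 1 else 0) Data.Nat.+ card n (λ i → S (suc i))

fourier : (n : ℕ) → (Cube n → Bool) → SubsetOf n → ℚ
fourier n f S = 𝔼 n (λ x → val (f x) * χ n S x)

T : (n : ℕ) → ℚ → (Cube n → Bool) → Cube n → ℚ
T n ρ f y = Σcube n (λ S → (ρ ^ℚ card n S) * (fourier n f S * χ n S y))

sgn : ℚ → ℚ
sgn q = if ⌊ 0ℚ <? q ⌋ then 1ℚ else (if ⌊ q <? 0ℚ ⌋ then - 1ℚ else 0ℚ)

IsSP : (n : ℕ) → ℚ → (Cube n → Bool) → Set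
IsSP n ρ f = ∀ (y : Cube n) → T n ρ f y ≢ 0ℚ → val (f y) ≡ sgn (T n ρ f y)

IsLCSP : (n : ℕ) → (Cube n → Bool) → Set
IsLCSP n f = Σ ℚ (λ ρ* → (0ℚ < ρ*) ×
  (∀ (ρ : ℚ) → 0ℚ ≤ ρ → ρ ≤ 1ℚ → ρ < ρ* → IsSP n ρ f))

PrTrue : (n : ℕ) → (Cube n → Bool) → ℚ
PrTrue n f = 𝔼 n (λ x → if f x then 1ℚ else 0ℚ)

IsBalanced : (n : ℕ) → (Cube n → Bool) → Set
IsBalanced n f = PrTrue n f ≡ ½

IsConstant : (n : ℕ) → (Cube n → Bool) → Set
IsConstant n f = Σ Bool (λ c → ∀ (x : Cube n) → f x ≡ c)

module Submission where

-- At ρ = 0 every Fourier weight ρ^|S| with S ≠ ∅ vanishes,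
-- so T₀ f is the constant function y ↦ f̂_∅ = 𝔼[f].  Hence:
--   * if 𝔼[f] = 0, then Pr(f = 1) = (𝔼[f] + 1)/2 = ½, i.e. f is balanced;
--   * if 𝔼[f] ≠ 0, then 0-SP says f(y) = sgn 𝔼[f] for every y, so f is
--     constant.

open import Defs
open import Data.Nat using (ℕ; zero; suc)
open import Data.Bool using (Bool; true; false; if_then_else_)
open import Data.Sum using (_⊎_; inj₁; inj₂)
open import Data.Fin using (Fin)
open import Data.List using (List; []; _∷_; map; _++_)
open import Data.Product using (_,_)
open import Data.Rational using (ℚ; 0ℚ; 1ℚ; ½; _+_; _*_; _≤_; _≤?_)
open import Data.Rational.Properties
  using (+-assoc; +-comm; +-identityˡ; +-identityʳ; *-assoc; *-comm;
         *-identityˡ; *-identityʳ; *-zeroˡ; *-zeroʳ; *-distribˡ-+; ≤-refl; _≟_)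
open import Relation.Nullary using (yes; no)
open import Relation.Nullary.Decidable using (toWitness)
open import Data.Unit using (tt)
open import Relation.Binary.PropositionalEquality
open ≡-Reasoning

sum-++ : {A : Set} (g : A → ℚ) (xs ys : List A) →
         sumℚ (map g (xs ++ ys)) ≡ sumℚ (map g xs) + sumℚ (map g ys)
sum-++ g []       ys = sym (+-identityˡ _)
sum-++ g (x ∷ xs) ys =
  trans (cong (g x +_) (sum-++ g xs ys)) (sym (+-assoc (g x) _ _))

sum-map : {A B : Set} (g : B → ℚ) (h : A → B) (xs : List A) →
          sumℚ (map g (map h xs)) ≡ sumℚ (map (λ x → g (h x)) xs)
sum-map g h []       = refl
sum-map g h (x ∷ xs) = cong (g (h x) +_) (sum-map g h xs)

sum-cong : {A : Set} {g g' : A → ℚ} → (∀ x → g x ≡ g' x) → (xs : List A) →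
           sumℚ (map g xs) ≡ sumℚ (map g' xs)
sum-cong e []       = refl
sum-cong e (x ∷ xs) = cong₂ _+_ (e x) (sum-cong e xs)

sum-zero : {A : Set} {g : A → ℚ} → (∀ x → g x ≡ 0ℚ) → (xs : List A) →
           sumℚ (map g xs) ≡ 0ℚ
sum-zero e []       = refl
sum-zero e (x ∷ xs) = cong₂ _+_ (e x) (sum-zero e xs)

sum-scale : {A : Set} (c : ℚ) (g : A → ℚ) (xs : List A) →
            sumℚ (map (λ x → c * g x) xs) ≡ c * sumℚ (map g xs)
sum-scale c g []       = sym (*-zeroʳ c)
sum-scale c g (x ∷ xs) =
  trans (cong (c * g x +_) (sum-scale c g xs)) (sym (*-distribˡ-+ c (g x) _))

interchange : (a b c d : ℚ) → (a + b) + (c + d) ≡ (a + c) + (b + d)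
interchange a b c d = begin
  (a + b) + (c + d)   ≡⟨ +-assoc a b (c + d) ⟩
  a + (b + (c + d))   ≡⟨ cong (a +_) (sym (+-assoc b c d)) ⟩
  a + ((b + c) + d)   ≡⟨ cong (λ z → a + (z + d)) (+-comm b c) ⟩
  a + ((c + b) + d)   ≡⟨ cong (a +_) (+-assoc c b d) ⟩
  a + (c + (b + d))   ≡⟨ sym (+-assoc a c (b + d)) ⟩
  (a + c) + (b + d)   ∎

sum-add : {A : Set} (g h : A → ℚ) (xs : List A) →
          sumℚ (map (λ x → g x + h x) xs) ≡ sumℚ (map g xs) + sumℚ (map h xs)
sum-add g h []       = refl
sum-add g h (x ∷ xs) =
  trans (cong ((g x + h x) +_) (sum-add g h xs))
        (interchange (g x) (h x) (sumℚ (map g xs)) (sumℚ (map h xs)))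

Σcube-suc : (n : ℕ) (g : Cube (suc n) → ℚ) →
            Σcube (suc n) g ≡ Σcube n (λ x → g (cons true x)) + Σcube n (λ x → g (cons false x))
Σcube-suc n g =
  trans (sum-++ g (map (cons true) (allCube n)) (map (cons false) (allCube n)))
        (cong₂ _+_ (sum-map g (cons true) (allCube n)) (sum-map g (cons false) (allCube n)))

𝔼-cong : (n : ℕ) {g g' : Cube n → ℚ} → (∀ x → g x ≡ g' x) → 𝔼 n g ≡ 𝔼 n g'
𝔼-cong n e = cong ((½ ^ℚ n) *_) (sum-cong e (allCube n))

𝔼-scale : (n : ℕ) (c : ℚ) (g : Cube n → ℚ) → 𝔼 n (λ x → c * g x) ≡ c * 𝔼 n g
𝔼-scale n c g = begin
  P * Σcube n (λ x → c * g x) ≡⟨ cong (P *_) (sum-scale c g (allCube n)) ⟩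
  P * (c * Σcube n g)         ≡⟨ sym (*-assoc P c _) ⟩
  (P * c) * Σcube n g         ≡⟨ cong (_* Σcube n g) (*-comm P c) ⟩
  (c * P) * Σcube n g         ≡⟨ *-assoc c P _ ⟩
  c * 𝔼 n g                   ∎
  where P = ½ ^ℚ n

𝔼-add : (n : ℕ) (g h : Cube n → ℚ) → 𝔼 n (λ x → g x + h x) ≡ 𝔼 n g + 𝔼 n h
𝔼-add n g h = trans (cong ((½ ^ℚ n) *_) (sum-add g h (allCube n)))
                    (*-distribˡ-+ (½ ^ℚ n) (Σcube n g) (Σcube n h))

𝔼-one : (n : ℕ) → 𝔼 n (λ _ → 1ℚ) ≡ 1ℚ
𝔼-one zero    = refl
𝔼-one (suc n) = begin
  (½ * P) * Σcube (suc n) (λ _ → 1ℚ) ≡⟨ cong ((½ * P) *_) (Σcube-suc n (λ _ → 1ℚ)) ⟩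
  (½ * P) * (S + S)                  ≡⟨ *-assoc ½ P (S + S) ⟩
  ½ * (P * (S + S))                  ≡⟨ cong (½ *_) (*-distribˡ-+ P S S) ⟩
  ½ * (P * S + P * S)                ≡⟨ cong (λ z → ½ * (z + z)) (𝔼-one n) ⟩
  ½ * (1ℚ + 1ℚ)                      ≡⟨⟩
  1ℚ                                 ∎
  where P = ½ ^ℚ n; S = Σcube n (λ _ → 1ℚ)

indicator-val : (b : Bool) → (if b then 1ℚ else 0ℚ) ≡ ½ * (val b + 1ℚ)
indicator-val true  = refl
indicator-val false = refl

PrTrue-mean : (n : ℕ) (f : Cube n → Bool) →
              PrTrue n f ≡ ½ * (𝔼 n (λ x → val (f x)) + 1ℚ)
PrTrue-mean n f = begin
  PrTrue n f                                          ≡⟨ 𝔼-cong n (λ x → indicator-val (f x)) ⟩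
  𝔼 n (λ x → ½ * (val (f x) + 1ℚ))                    ≡⟨ 𝔼-scale n ½ (λ x → val (f x) + 1ℚ) ⟩
  ½ * 𝔼 n (λ x → val (f x) + 1ℚ)                      ≡⟨ cong (½ *_) (𝔼-add n (λ x → val (f x)) (λ _ → 1ℚ)) ⟩
  ½ * (𝔼 n (λ x → val (f x)) + 𝔼 n (λ _ → 1ℚ))        ≡⟨ cong (λ z → ½ * (𝔼 n (λ x → val (f x)) + z)) (𝔼-one n) ⟩
  ½ * (𝔼 n (λ x → val (f x)) + 1ℚ)                    ∎

mean-zero⇒balanced : (n : ℕ) (f : Cube n → Bool) → 𝔼 n (λ x → val (f x)) ≡ 0ℚ → IsBalanced n f
mean-zero⇒balanced n f e = trans (PrTrue-mean n f) (cong (λ z → ½ * (z + 1ℚ)) e)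

∅ : (n : ℕ) → SubsetOf n
∅ zero    = λ ()
∅ (suc n) = cons false (∅ n)

χ-∅ : (n : ℕ) (y : Cube n) → χ n (∅ n) y ≡ 1ℚ
χ-∅ zero    y = refl
χ-∅ (suc n) y = trans (*-identityˡ _) (χ-∅ n (λ i → y (Fin.suc i)))

Σ-zero-weights : (n : ℕ) (h : SubsetOf n → ℚ) →
                 Σcube n (λ S → (0ℚ ^ℚ card n S) * h S) ≡ h (∅ n)
Σ-zero-weights zero    h = trans (+-identityʳ _) (*-identityˡ _)
Σ-zero-weights (suc n) h = begin
  Σcube (suc n) w                                     ≡⟨ Σcube-suc n w ⟩
  Σcube n (λ S → w (cons true S)) + Σcube n (λ S → w (cons false S))
                                                      ≡⟨ cong₂ _+_ (sum-zero nonempty (allCube n))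
                                                                    (Σ-zero-weights n (λ S → h (cons false S))) ⟩
  0ℚ + h (∅ (suc n))                                  ≡⟨ +-identityˡ _ ⟩
  h (∅ (suc n))                                       ∎
  where
  w : SubsetOf (suc n) → ℚ
  w S = (0ℚ ^ℚ card (suc n) S) * h S
  -- subsets containing the first coordinate have weight 0^(1+|S|) = 0
  nonempty : ∀ S → w (cons true S) ≡ 0ℚ
  nonempty S = trans (cong (_* h (cons true S)) (*-zeroˡ (0ℚ ^ℚ card n S))) (*-zeroˡ (h (cons true S)))

T-zero : (n : ℕ) (f : Cube n → Bool) (y : Cube n) → T n 0ℚ f y ≡ 𝔼 n (λ x → val (f x))
T-zero n f y = begin
  T n 0ℚ f y                                ≡⟨ Σ-zero-weights n (λ S → fourier n f S * χ n S y) ⟩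
  fourier n f (∅ n) * χ n (∅ n) y           ≡⟨ cong (fourier n f (∅ n) *_) (χ-∅ n y) ⟩
  fourier n f (∅ n) * 1ℚ                    ≡⟨ *-identityʳ _ ⟩
  fourier n f (∅ n)                         ≡⟨ 𝔼-cong n (λ x → trans (cong (val (f x) *_) (χ-∅ n x)) (*-identityʳ _)) ⟩
  𝔼 n (λ x → val (f x))                     ∎

val-injective : (a b : Bool) → val a ≡ val b → a ≡ b
val-injective true  true  _ = refl
val-injective false false _ = refl
val-injective true  false ()
val-injective false true  ()

val-constant⇒constant : (n : ℕ) (f : Cube n → Bool) (c : ℚ) →
                        (∀ x → val (f x) ≡ c) → IsConstant n f
val-constant⇒constant n f c h =
  f y₀ , λ x → val-injective (f x) (f y₀) (trans (h x) (sym (h y₀)))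
  where
  y₀ : Cube n
  y₀ = λ _ → true

zero-SP⇒balanced-or-constant : (n : ℕ) (f : Cube n → Bool) → IsSP n 0ℚ f →
                               IsBalanced n f ⊎ IsConstant n f
zero-SP⇒balanced-or-constant n f sp with 𝔼 n (λ x → val (f x)) ≟ 0ℚ
... | yes mean≡0 = inj₁ (mean-zero⇒balanced n f mean≡0)
... | no  mean≢0 = inj₂ (val-constant⇒constant n f (sgn mean) follows-sign)
  where
  mean : ℚ
  mean = 𝔼 n (λ x → val (f x))
  follows-sign : ∀ x → val (f x) ≡ sgn mean
  follows-sign x = trans (sp x (λ T≡0 → mean≢0 (trans (sym (T-zero n f x)) T≡0)))
                         (cong sgn (T-zero n f x))

corollary5p2 : (n : ℕ) (f : Cube n → Bool) → IsLCSP n f → IsBalanced n f ⊎ IsConstant n f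
corollary5p2 n f (ρ* , 0<ρ* , sp) =
  zero-SP⇒balanced-or-constant n f (sp 0ℚ ≤-refl 0≤1 0<ρ*)
  where
  0≤1 : 0ℚ ≤ 1ℚ
  0≤1 = toWitness {a? = 0ℚ ≤? 1ℚ} tt
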